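{- Let $n\ge 0$ and let $i\ge j\ge 0$ be integers with $i+j\le n$ and $i+j\equiv n\pmod 2$. Let $$\mathcal{M}^{(2)}_{n,i;j}=\{(P,Q): P,Q \text{ paths of length } n,\ -P\le Q\le P,\ h(P)=i+j,\ h(Q)=i-j\},$$ $$\mathcal{P}^{(2)}_{n,i;j}=\{(P,Q): P,Q \text{ paths of length } n,\ 0\le Q\le P,\ i-j\le h(Q)\le i+j\le h(P)\}.$$ Then $\varphi(\mathcal{M}^{(2)}_{n,i;j})\subseteq\mathcal{P}^{(2)}_{n,i;j}$, where $\varphi$ is the map defined in the context.
   Context: A path of length $n$ is a lattice path in $\mathbb{Z}^2$ starting at $(0,0)$ with $n$ steps, each $U=(1,1)$ or $D=(1,-1)$. $h_a(P)$ is the $y$-coordinate at $x=a$, $h(P)=h_n(P)$; $Q\le P$ means $h_a(Q)\le h_a(P)$ for all $a$; $0\le Q$ means $h_a(Q)\ge0$ for all $a$; $-P$ is the reflection of $P$ in the $x$-axis. Flipping a step means changing $U$ to $D$ or vice versa. The disagreement path $(P-Q)/2$ is the path with steps $U,D,H=(1,0)$ whose height at each $a$ is $(h_a(P)-h_a(Q))/2$. Matching: ignoring $H$ steps and reading left to right, regard $U$ as "(" and $D$ as ")", and match each $D$ with the nearest preceding not-yet-matched $U$, if any; the remaining $U$ and $D$ steps are unmatched. The map $\varphi$: given $(P,Q)$, let $Q'$ be obtained from $Q$ by flipping every step ending strictly below the $x$-axis; let $\chi$ be the set of positions of the unmatched $D$ steps of $(P-Q')/2$; let $\widetilde P,\widetilde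 Q$ be obtained from $P,Q'$ by flipping the steps in positions $\chi$; set $\varphi(P,Q)=(\widetilde P,\widetilde Q)$. -}

module Defs where

open import Data.Nat using (ℕ; zero; suc)
open import Data.Bool using (Bool; true; false; if_then_else_)
open import Data.Vec using (Vec; []; _∷_)
open import Data.Integer using (ℤ; +_; -_; _+_; _-_; _<?_; _≤_)
import Data.Nat
open import Relation.Binary.PropositionalEquality using (_≡_)
open import Data.Product using (_×_; _,_)
open import Relation.Nullary.Decidable using (⌊_⌋)

-- Steps U = (1,1), D = (1,-1)
data Step : Set where
  U D : Step

Path : ℕ → Set
Path n = Vec Step n

val : Step → ℤ
val U = + 1
val D = - (+ 1)

flip : Step → Step
flip U = D
flip D = U

-- ht P a = h_a(P), the y-coordinate at x = a (meaningful for a ≤ n;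
-- for a > n it equals h(P)).
ht : ∀ {n} → Path n → ℕ → ℤ
ht P zero = + 0
ht [] (suc a) = + 0
ht (s ∷ P) (suc a) = val s + ht P a

h : ∀ {n} → Path n → ℤ
h [] = + 0
h (s ∷ P) = val s + h P

_≤P_ : ∀ {n} → Path n → Path n → Set
_≤P_ {n} Q P = ∀ a → a Data.Nat.≤ n → ht Q a ≤ ht P a

0≤P_ : ∀ {n} → Path n → Set
0≤P_ {n} Q = ∀ a → a Data.Nat.≤ n → + 0 ≤ ht Q a

negP : ∀ {n} → Path n → Path n
negP [] = []
negP (s ∷ P) = flip s ∷ negP P

-- Q' : flip every step of Q ending strictly below the x-axis.
-- c is the (original) height of Q before the current step.
flipBelowFrom : ∀ {n} → ℤ → Path n → Path n
flipBelowFrom c [] = []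
flipBelowFrom c (s ∷ Q) =
  (if ⌊ (c + val s) <? + 0 ⌋ then flip s else s) ∷ flipBelowFrom (c + val s) Q

flipBelow : ∀ {n} → Path n → Path n
flipBelow = flipBelowFrom (+ 0)

-- steps of the disagreement path (P - Q)/2 : U, D, or H = (1,0)
data DStep : Set where
  dU dD dH : DStep

disagree : ∀ {n} → Path n → Path n → Vec DStep n
disagree [] [] = []
disagree (U ∷ P) (D ∷ Q) = dU ∷ disagree P Q
disagree (D ∷ P) (U ∷ Q) = dD ∷ disagree P Q
disagree (U ∷ P) (U ∷ Q) = dH ∷ disagree P Q
disagree (D ∷ P) (D ∷ Q) = dH ∷ disagree P Q

-- Matching: scan left to right, ignoring H; k = number of currently
-- unmatched U's. A D is matched with the nearest preceding unmatched U
-- if k > 0; otherwise it is unmatched.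
unmatchedDFrom : ∀ {n} → ℕ → Vec DStep n → Vec Bool n
unmatchedDFrom k [] = []
unmatchedDFrom k (dU ∷ R) = false ∷ unmatchedDFrom (suc k) R
unmatchedDFrom k (dH ∷ R) = false ∷ unmatchedDFrom k R
unmatchedDFrom zero (dD ∷ R) = true ∷ unmatchedDFrom zero R
unmatchedDFrom (suc k) (dD ∷ R) = false ∷ unmatchedDFrom k R

unmatchedD : ∀ {n} → Vec DStep n → Vec Bool n
unmatchedD = unmatchedDFrom 0

flipAt : ∀ {n} → Vec Bool n → Path n → Path n
flipAt [] [] = []
flipAt (b ∷ χ) (s ∷ P) = (if b then flip s else s) ∷ flipAt χ P

φ : ∀ {n} → Path n → Path n → Path n × Path n
φ P Q = let Q' = flipBelow Q
            χ  = unmatchedD (disagree P Q')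
        in flipAt χ P , flipAt χ Q'

InM : (n i j : ℕ) → Path n → Path n → Set
InM n i j P Q = (negP P ≤P Q) × (Q ≤P P)
              × (h P ≡ + (i Data.Nat.+ j))
              × (h Q ≡ (+ i - + j))

InPP : (n i j : ℕ) → Path n → Path n → Set
InPP n i j P Q = (0≤P Q) × (Q ≤P P)
               × ((+ i - + j) ≤ h Q)
               × (h Q ≤ + (i Data.Nat.+ j))
               × (+ (i Data.Nat.+ j) ≤ h P)

-- Write Q' for Q with its steps below the axis flipped, and Q̃, P̃ for the images of Q', P under
-- the flips at the unmatched D steps of (P - Q')/2. At every abscissa ∣Q∣ ≤ Q̃ ≤ P ≤ P̃: P̃ - P
-- grows at each flip, P - Q̃ is twice the number of open U steps of the matching, and Q̃ - ∣Q∣ is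
-- even and never negative. The latter grows by 2 when Q returns from -1 to 0 (Q' rises, ∣Q∣
-- falls) and drops by 2 only at an unmatched D taken while ∣Q∣ rises, which ∣Q∣ ≤ P forbids once
-- Q̃ = ∣Q∣ = P. Every condition of the target set is read off this chain.
module Submission where

open import Defs
open import Data.Product using (proj₁; proj₂)
open import Relation.Binary.PropositionalEquality using (_≡_)

open import Data.Bool using (if_then_else_)
open import Data.Empty using (⊥-elim)
open import Data.Nat using (zero; suc; z≤n; s≤s)
import Data.Nat as ℕ
import Data.Nat.Properties as ℕ
open import Data.Product using (Σ-syntax; _×_; _,_)
open import Data.Sum using (inj₁; inj₂)
open import Data.Vec using ([]; _∷_)
open import Function using (_∘_)
open import Relation.Binary.PropositionalEquality
  using (refl; sym; trans; cong; cong₂; subst; subst₂; module ≡-Reasoning)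
open import Relation.Nullary.Decidable using (⌊_⌋)

module Heights where

  open import Data.Integer using (ℤ; +_; -[1+_]; -_; ∣_∣; _+_; _≤_; _<?_; +≤+; -≤+; -<+)
  import Data.Integer.Properties as ℤ
  open import Data.Integer.Tactic.RingSolver using (solve-∀)
  open ≡-Reasoning

  Everywhere : ℕ.ℕ → (ℕ.ℕ → Set) → Set
  Everywhere n F = ∀ a → a ℕ.≤ n → F a

  here : ∀ {F} → F 0 → Everywhere 0 F
  here p zero z≤n = p

  _◂_ : ∀ {n F} → F 0 → Everywhere n (F ∘ suc) → Everywhere (suc n) F
  (p ◂ ps) zero    _         = p
  (p ◂ ps) (suc a) (s≤s a≤n) = ps a a≤n

  later : ∀ {n F} → Everywhere (suc n) F → Everywhere n (F ∘ suc)
  later ps a a≤n = ps (suc a) (s≤s a≤n)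

  -- x + h_a(P), computed so that it unfolds on the first step of P.
  htFrom : ∀ {n} → ℤ → Path n → ℕ.ℕ → ℤ
  htFrom x P       zero    = x
  htFrom x []      (suc a) = x
  htFrom x (s ∷ P) (suc a) = htFrom (x + val s) P a

  htFrom≡+ht : ∀ {n} x (P : Path n) a → htFrom x P a ≡ x + ht P a
  htFrom≡+ht x P       zero    = sym (ℤ.+-identityʳ x)
  htFrom≡+ht x []      (suc a) = sym (ℤ.+-identityʳ x)
  htFrom≡+ht x (s ∷ P) (suc a) = trans (htFrom≡+ht (x + val s) P a) (ℤ.+-assoc x (val s) (ht P a))

  htFrom-0 : ∀ {n} (P : Path n) a → htFrom (+ 0) P a ≡ ht P a
  htFrom-0 P a = trans (htFrom≡+ht (+ 0) P a) (ℤ.+-identityˡ (ht P a))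

  h≡ht : ∀ {n} (P : Path n) → h P ≡ ht P n
  h≡ht []      = refl
  h≡ht (s ∷ P) = cong (_+_ (val s)) (h≡ht P)

  ht-negP : ∀ {n} (P : Path n) a → ht (negP P) a ≡ - ht P a
  ht-negP P       zero    = refl
  ht-negP []      (suc a) = refl
  ht-negP (s ∷ P) (suc a) = begin
    val (flip s) + ht (negP P) a ≡⟨ cong₂ _+_ (val-flip s) (ht-negP P a) ⟩
    - val s + - ht P a           ≡⟨ ℤ.neg-distrib-+ (val s) (ht P a) ⟨
    - (val s + ht P a)           ∎
    where
    val-flip : ∀ s → val (flip s) ≡ - val s
    val-flip U = refl
    val-flip D = refl

  reflectedStep : ℤ → Step → Step
  reflectedStep c s = if ⌊ c + val s <? + 0 ⌋ then flip s else s

  -- s' is the step of Q' above the step s of Q taken from height c. Q' rises while ∣Q∣ falls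
  -- only when Q returns from -1 to 0.
  data Reflection (c : ℤ) (s : Step) : Step → Set where
    away   : + ∣ c + val s ∣ ≡ + ∣ c ∣ + val U → Reflection c s U
    toward : + ∣ c + val s ∣ ≡ + ∣ c ∣ + val D → Reflection c s D
    return : + ∣ c + val s ∣ ≡ + ∣ c ∣ + val D → Reflection c s U

  reflection : ∀ c s → Reflection c s (reflectedStep c s)
  reflection (+ _)        U = away refl
  reflection (+ zero)     D = away refl
  reflection (+ suc _)    D = toward refl
  reflection -[1+ a ]     D = away (cong (+_ ∘ suc) (sym (ℕ.+-suc a 0)))
  reflection -[1+ zero ]  U = return refl
  reflection -[1+ suc _ ] U = toward refl

  infixl 6 _+2×_
  _+2×_ : ℤ → ℕ.ℕ → ℤ
  a +2× e = a + + e + + e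

  +2×-shift : ∀ a e s → (a +2× e) + s ≡ (a + s) +2× e
  +2×-shift a e = shift a (+ e)
    where
    shift : ∀ a E s → a + E + E + s ≡ a + s + E + E
    shift = solve-∀

  +2×-up : ∀ a e → (a +2× e) + val U ≡ (a + val D) +2× suc e
  +2×-up a e = up a (+ e)
    where
    up : ∀ a E → a + E + E + + 1 ≡ a + - + 1 + (+ 1 + E) + (+ 1 + E)
    up = solve-∀

  +2×-down : ∀ a e → (a +2× suc e) + val D ≡ (a + val U) +2× e
  +2×-down a e = down a (+ e)
    where
    down : ∀ a E → a + (+ 1 + E) + (+ 1 + E) + - + 1 ≡ a + + 1 + E + E
    down = solve-∀

  +2×-zero : ∀ a → a +2× 0 ≡ a
  +2×-zero a = trans (ℤ.+-identityʳ (a + + 0)) (ℤ.+-identityʳ a)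

  a≤a+2×e : ∀ a e → a ≤ a +2× e
  a≤a+2×e a e = ℤ.≤-trans (ℤ.i≤i+j a (+ e)) (ℤ.i≤i+j (a + + e) (+ e))

  EvenlyAbove : ℕ.ℕ → ℤ → Set
  EvenlyAbove m y = Σ[ e ∈ ℕ.ℕ ] y ≡ + m +2× e

  rebase : ∀ {m' y} a t e → + m' ≡ a + t → y ≡ (a + t) +2× e → EvenlyAbove m' y
  rebase a t e m'≡a+t y≡ = e , trans y≡ (cong (_+2× e) (sym m'≡a+t))

  evenlyAbove-follow : ∀ {c s s' y} → Reflection c s s' → EvenlyAbove ∣ c ∣ y →
                       EvenlyAbove ∣ c + val s ∣ (y + val s')
  evenlyAbove-follow {c} (away eq)   (e , refl) =
    rebase (+ ∣ c ∣) (val U) e eq (+2×-shift (+ ∣ c ∣) e (val U))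
  evenlyAbove-follow {c} (toward eq) (e , refl) =
    rebase (+ ∣ c ∣) (val D) e eq (+2×-shift (+ ∣ c ∣) e (val D))
  evenlyAbove-follow {c} (return eq) (e , refl) =
    rebase (+ ∣ c ∣) (val D) (suc e) eq (+2×-up (+ ∣ c ∣) e)

  -- At an unmatched D the step of Q' (a U) is flipped, so Q̃ falls; y + val D bounds the next ∣Q∣
  -- because P and Q̃ coincide when no U is open.
  evenlyAbove-unmatched : ∀ {c s y} → Reflection c s U → EvenlyAbove ∣ c ∣ y →
                          + ∣ c + val s ∣ ≤ y + val D → EvenlyAbove ∣ c + val s ∣ (y + val D)
  evenlyAbove-unmatched {c} (away eq) (zero , refl) bound =
    ⊥-elim (ℤ.≤⇒≯ ∣c∣+1≤∣c∣-1 (ℤ.+-monoʳ-< (+ ∣ c ∣) -<+))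
    where
    ∣c∣+1≤∣c∣-1 : + ∣ c ∣ + val U ≤ + ∣ c ∣ + val D
    ∣c∣+1≤∣c∣-1 = subst₂ _≤_ eq (cong (_+ val D) (+2×-zero (+ ∣ c ∣))) bound
  evenlyAbove-unmatched {c} (away eq)   (suc e , refl) _ =
    rebase (+ ∣ c ∣) (val U) e eq (+2×-down (+ ∣ c ∣) e)
  evenlyAbove-unmatched {c} (return eq) (e , refl)     _ =
    rebase (+ ∣ c ∣) (val D) e eq (+2×-shift (+ ∣ c ∣) e (val D))

  -- m, x, y are the current values of ∣Q∣, P and Q̃, and k is the number of open U steps of the
  -- matching.
  record Invariant (m k : ℕ.ℕ) (x y : ℤ) : Set where
    constructor invariant
    field
      level : EvenlyAbove m y
      gap   : x ≡ y +2× k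

  invariant-flat : ∀ {c s s' k x y} → Reflection c s s' → Invariant ∣ c ∣ k x y →
                   Invariant ∣ c + val s ∣ k (x + val s') (y + val s')
  invariant-flat {s' = s'} {k} {y = y} ρ (invariant level refl) =
    invariant (evenlyAbove-follow ρ level) (+2×-shift y k (val s'))

  invariant-open : ∀ {c s k x y} → Reflection c s D → Invariant ∣ c ∣ k x y →
                   Invariant ∣ c + val s ∣ (suc k) (x + val U) (y + val D)
  invariant-open {k = k} {y = y} ρ (invariant level refl) =
    invariant (evenlyAbove-follow ρ level) (+2×-up y k)

  invariant-close : ∀ {c s k x y} → Reflection c s U → Invariant ∣ c ∣ (suc k) x y →
                    Invariant ∣ c + val s ∣ k (x + val D) (y + val U)
  invariant-close {k = k} {y = y} ρ (invariant level refl) =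
    invariant (evenlyAbove-follow ρ level) (+2×-down y k)

  invariant-unmatched : ∀ {c s x y} → Reflection c s U → Invariant ∣ c ∣ 0 x y →
                        + ∣ c + val s ∣ ≤ x + val D → Invariant ∣ c + val s ∣ 0 (x + val D) (y + val D)
  invariant-unmatched {c} {s} {y = y} ρ (invariant level refl) bound =
    invariant (evenlyAbove-unmatched ρ level (subst (λ x → + ∣ c + val s ∣ ≤ x + val D) (+2×-zero y) bound))
              (+2×-shift y 0 (val D))

  Chain : ℕ.ℕ → ℤ → ℤ → ℤ → Set
  Chain m y x z = + m ≤ y × y ≤ x × x ≤ z

  chain : ∀ {m k x y z} → Invariant m k x y → x ≤ z → Chain m y x z
  chain {k = k} (invariant (e , refl) refl) x≤z = a≤a+2×e _ e , a≤a+2×e _ k , x≤z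

  AbsBelow : ∀ {n} → ℤ → ℤ → Path n → Path n → Set
  AbsBelow {n} c x Q P = Everywhere n λ a → + ∣ htFrom c Q a ∣ ≤ htFrom x P a

  ChainFrom : ∀ {n} → ℤ → ℕ.ℕ → (x y z : ℤ) → (P Q Q' : Path n) → Set
  ChainFrom {n} c k x y z P Q Q' =
    Everywhere n λ a → Chain ∣ htFrom c Q a ∣ (htFrom y (flipAt χ Q') a) (htFrom x P a) (htFrom z (flipAt χ P) a)
    where χ = unmatchedDFrom k (disagree P Q')

  mutual
    heights-chain : ∀ {n} c k {x y z} (P Q : Path n) → Invariant ∣ c ∣ k x y → x ≤ z →
                    AbsBelow c x Q P → ChainFrom c k x y z P Q (flipBelowFrom c Q)
    heights-chain c k []       []       inv x≤z _     = here (chain inv x≤z)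
    heights-chain c k (sP ∷ P) (sQ ∷ Q) inv x≤z below =
      heights-chain-∷ c k sP sQ P Q (reflection c sQ) inv x≤z below

    heights-chain-∷ : ∀ {n} c k {x y z} sP sQ {s'} (P Q : Path n) → Reflection c sQ s' →
                      Invariant ∣ c ∣ k x y → x ≤ z → AbsBelow c x (sQ ∷ Q) (sP ∷ P) →
                      ChainFrom c k x y z (sP ∷ P) (sQ ∷ Q) (s' ∷ flipBelowFrom (c + val sQ) Q)
    heights-chain-∷ c k U sQ {U} P Q ρ inv x≤z below =
      chain inv x≤z ◂ heights-chain (c + val sQ) k P Q
        (invariant-flat ρ inv) (ℤ.+-monoˡ-≤ (val U) x≤z) (later below)
    heights-chain-∷ c k D sQ {D} P Q ρ inv x≤z below =
      chain inv x≤z ◂ heights-chain (c + val sQ) k P Q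
        (invariant-flat ρ inv) (ℤ.+-monoˡ-≤ (val D) x≤z) (later below)
    heights-chain-∷ c k U sQ {D} P Q ρ inv x≤z below =
      chain inv x≤z ◂ heights-chain (c + val sQ) (suc k) P Q
        (invariant-open ρ inv) (ℤ.+-monoˡ-≤ (val U) x≤z) (later below)
    heights-chain-∷ c (suc k) D sQ {U} P Q ρ inv x≤z below =
      chain inv x≤z ◂ heights-chain (c + val sQ) k P Q
        (invariant-close ρ inv) (ℤ.+-monoˡ-≤ (val D) x≤z) (later below)
    heights-chain-∷ c zero D sQ {U} P Q ρ inv x≤z below =
      chain inv x≤z ◂ heights-chain (c + val sQ) zero P Q
        (invariant-unmatched ρ inv (below 1 (s≤s z≤n))) (ℤ.+-mono-≤ x≤z -≤+) (later below)

  i≤+∣i∣ : ∀ i → i ≤ + ∣ i ∣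
  i≤+∣i∣ (+ _)    = ℤ.≤-refl
  i≤+∣i∣ -[1+ _ ] = -≤+

  +∣i∣≤j : ∀ {i j} → - j ≤ i → i ≤ j → + ∣ i ∣ ≤ j
  +∣i∣≤j {i} {j} -j≤i i≤j with ℤ.+∣i∣≡i⊎+∣i∣≡-i i
  ... | inj₁ ∣i∣≡i  = subst (_≤ j) (sym ∣i∣≡i) i≤j
  ... | inj₂ ∣i∣≡-i = subst₂ _≤_ (sym ∣i∣≡-i) (ℤ.neg-involutive j) (ℤ.neg-mono-≤ -j≤i)

  Chains : ∀ {n} → (Q Q̃ P P̃ : Path n) → Set
  Chains {n} Q Q̃ P P̃ = Everywhere n λ a → Chain ∣ ht Q a ∣ (ht Q̃ a) (ht P a) (ht P̃ a)

  φ-chains : ∀ {n} (P Q : Path n) → negP P ≤P Q → Q ≤P P → Chains Q (proj₂ (φ P Q)) P (proj₁ (φ P Q))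
  φ-chains P Q -P≤Q Q≤P a a≤n
    rewrite sym (htFrom-0 Q a) | sym (htFrom-0 (proj₂ (φ P Q)) a)
          | sym (htFrom-0 P a) | sym (htFrom-0 (proj₁ (φ P Q)) a)
    = heights-chain (+ 0) 0 P Q (invariant (0 , refl) refl) ℤ.≤-refl below a a≤n
    where
    below : AbsBelow (+ 0) (+ 0) Q P
    below a a≤n = subst₂ (λ q p → + ∣ q ∣ ≤ p) (sym (htFrom-0 Q a)) (sym (htFrom-0 P a))
      (+∣i∣≤j (subst (_≤ ht Q a) (ht-negP P a) (-P≤Q a a≤n)) (Q≤P a a≤n))

  chain-at-end : ∀ {n} {Q Q̃ P P̃ : Path n} → Chains Q Q̃ P P̃ → Chain ∣ h Q ∣ (h Q̃) (h P) (h P̃)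
  chain-at-end {n} {Q} {Q̃} {P} {P̃} chains
    rewrite h≡ht Q | h≡ht Q̃ | h≡ht P | h≡ht P̃ = chains n ℕ.≤-refl

  chains⇒0≤Q̃ : ∀ {n} {Q Q̃ P P̃ : Path n} → Chains Q Q̃ P P̃ → 0≤P Q̃
  chains⇒0≤Q̃ chains a a≤n = ℤ.≤-trans (+≤+ z≤n) (proj₁ (chains a a≤n))

  chains⇒Q̃≤P̃ : ∀ {n} {Q Q̃ P P̃ : Path n} → Chains Q Q̃ P P̃ → Q̃ ≤P P̃
  chains⇒Q̃≤P̃ chains a a≤n = let _ , Q̃≤P , P≤P̃ = chains a a≤n in ℤ.≤-trans Q̃≤P P≤P̃

open Heights using (φ-chains; chain-at-end; chains⇒0≤Q̃; chains⇒Q̃≤P̃; i≤+∣i∣)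

open import Data.Nat using (ℕ; _≤_; _+_; _%_)
import Data.Integer as ℤ
import Data.Integer.Properties as ℤ

-- The conditions on n, i and j only make the two sets nonempty; the inclusion does not need them.
lemma5p2 : (n i j : ℕ) → j ≤ i → i + j ≤ n → (i + j) % 2 ≡ n % 2 →
    (P Q : Path n) → InM n i j P Q →
    InPP n i j (proj₁ (φ P Q)) (proj₂ (φ P Q))
lemma5p2 n i j _ _ _ P Q (-P≤Q , Q≤P , hP≡i+j , hQ≡i-j) =
  let chains = φ-chains P Q -P≤Q Q≤P
      ∣Q∣≤Q̃ , Q̃≤P , P≤P̃ = chain-at-end chains
  in chains⇒0≤Q̃ chains ,
     chains⇒Q̃≤P̃ chains ,
     subst (ℤ._≤ h Q̃) hQ≡i-j (ℤ.≤-trans (i≤+∣i∣ (h Q)) ∣Q∣≤Q̃) ,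
     subst (h Q̃ ℤ.≤_) hP≡i+j Q̃≤P ,
     subst (ℤ._≤ h P̃) hP≡i+j P≤P̃
  where
  P̃ Q̃ : Path n
  P̃ = proj₁ (φ P Q)
  Q̃ = proj₂ (φ P Q)
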